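{- Let $\leq$ be a transitive relation on a finite nonempty set $S$. Define the relation $\leq'$ on $\mathcal{P}(S)$ by $A\leq' B$ iff for every $b\in B$ there is $a\in A$ with $a\leq b$. Then $\leq'$ is transitive and $\mathrm{mcl}(\leq')\leq 2\cdot|S_\equiv|\leq 2\cdot |S|$.
   Context: For a relation $\leq$ on a set $S$, $s<t$ means ($s\leq t$ and not $t\leq s$). For a transitive relation $\leq$ on a finite nonempty set $S$, the maximum chain length $\mathrm{mcl}(\leq)$ is the largest $l\in\mathbb{N}$ such that there exist $s_0,\dots,s_l\in S$ with $s_0<s_1<\dots<s_l$. For transitive $\leq$ on $S$, the equivalence relation $\equiv$ is defined by $s\equiv t$ iff ($s=t$ or ($s\leq t$ and $t\leq s$)), and $S_\equiv$ denotes the set of $\equiv$-equivalence classes. -}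

module Defs where

open import Data.Nat using (ℕ; suc; _*_) renaming (_≤_ to _≤ℕ_)
open import Data.Fin using (Fin; inject₁) renaming (suc to fsuc)
open import Data.Fin.Subset using (Subset; _∈_)
open import Data.Product using (Σ; ∃; _×_)
open import Data.Sum using (_⊎_)
open import Relation.Nullary using (¬_)
open import Relation.Binary.PropositionalEquality using (_≡_)
open import Function.Bundles using (_⇔_)
open import Function.Definitions using (Surjective)

Rel₀ : Set → Set₁
Rel₀ A = A → A → Set

Transitive₀ : {A : Set} → Rel₀ A → Set
Transitive₀ {A} R = ∀ {x y z : A} → R x y → R y z → R x z

Strict : {A : Set} → Rel₀ A → Rel₀ A
Strict R s t = R s t × ¬ R t s

StrictChain : {A : Set} → Rel₀ A → ℕ → Set
StrictChain {A} R l =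
  Σ (Fin (suc l) → A) λ s → (i : Fin l) → Strict R (s (inject₁ i)) (s (fsuc i))

IsMCL : {A : Set} → Rel₀ A → ℕ → Set
IsMCL R l = StrictChain R l × (∀ m → StrictChain R m → m ≤ℕ l)

Equiv : {A : Set} → Rel₀ A → Rel₀ A
Equiv R s t = s ≡ t ⊎ (R s t × R t s)

-- |S_≡| = k : there is a surjection c : S → Fin k whose fibres are exactly
-- the ≡-classes (i.e. a bijection S_≡ ≅ Fin k induced by the class map).
HasClassCount : {n : ℕ} → Rel₀ (Fin n) → ℕ → Set
HasClassCount {n} R k =
  Σ (Fin n → Fin k) λ c → Surjective _≡_ _≡_ c × (∀ s t → (c s ≡ c t) ⇔ Equiv R s t)

Lift : {n : ℕ} → Rel₀ (Fin n) → Rel₀ (Subset n)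
Lift R A B = ∀ b → b ∈ B → ∃ λ a → a ∈ A × R a b

module Submission where

-- Write ↑A = {s | ∃ a ∈ A, a ≤ s}, so that A ≤' B says B ⊆ ↑A. By transitivity ↑A and
-- A ∪ ↑A are unions of ≡-classes. If A <' B then B ∪ ↑B ⊆ ↑A ⊆ A ∪ ↑A, and since B ≰' A
-- some a ∈ A lies outside ↑B, so ↑B ⊊ A ∪ ↑A. Hence the number of classes meeting ↑A
-- plus the number meeting A ∪ ↑A drops strictly along a <'-chain, and it is at most
-- 2|S_≡|. Choosing a ∉ ↑B needs ≤ decidable; as the bound on l is itself decidable,
-- decidability of ≤ may be assumed under a double negation.

open import Defs
open import Data.Bool.Properties using (T-≡)
open import Data.Nat using (ℕ; zero; suc; _*_; _≤_; _<_; _+_; _≤?_; z≤n; s≤s)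
open import Data.Nat.Properties
  using (≤-trans; m≤m+n; +-mono-≤; +-mono-<-≤; +-comm; *-monoʳ-≤; module ≤-Reasoning)
open import Data.Fin using (Fin) renaming (zero to fzero; suc to fsuc)
open import Data.Fin.Properties using (any?; injective⇒≤; _≟_; sequence)
open import Data.Fin.Subset using (Subset; _∈_; _⊂_; ∣_∣) renaming (_⊆_ to _⊆ₛ_)
open import Data.Fin.Subset.Properties using (_∈?_; ∣p∣≤n; p⊆q⇒∣p∣≤∣q∣; p⊂q⇒∣p∣<∣q∣)
open import Data.Vec using (tabulate)
open import Data.Vec.Properties using (lookup∘tabulate; []=⇒lookup; lookup⇒[]=)
open import Data.Product using (_×_; _,_; proj₁; proj₂; ∃)
open import Data.Sum using (inj₁; inj₂)
open import Effect.Monad using (RawMonad)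
open import Function.Base using (_∘_)
open import Function.Bundles using (Equivalence; mk↠; RightInverse)
open import Function.Consequences.Propositional using (inverseʳ⇒injective)
open import Function.Definitions using (Surjective)
open import Function.Properties.Surjection using (↠⇒↪)
open import Level using (0ℓ)
open import Relation.Nullary using (¬_; Dec; yes; no)
open import Relation.Nullary.Decidable
  using (⌊_⌋; ¬?; _×-dec_; toWitness; fromWitness; decidable-stable; ¬¬-excluded-middle)
open import Relation.Nullary.Negation using (¬¬-Monad; ¬¬-map; contradiction)
open import Relation.Unary using (Pred; Decidable; _⊆_; _∪_)
open import Relation.Unary.Properties using (_∪?_)
open import Relation.Binary.PropositionalEquality using (_≡_; refl; sym; trans)

Lift-trans : ∀ {n} {R : Rel₀ (Fin n)} → Transitive₀ R → Transitive₀ (Lift R)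
Lift-trans R-trans A≤B B≤C c c∈C with B≤C c c∈C
... | b , b∈B , bRc with A≤B b b∈B
...   | a , a∈A , aRb = a , a∈A , R-trans aRb bRc

StrictChain-length≤measure : ∀ {A : Set} {R : Rel₀ A} (Φ : A → ℕ) →
  (∀ {x y} → Strict R x y → Φ y < Φ x) →
  ∀ l → ((s , _) : StrictChain R l) → l ≤ Φ (s fzero)
StrictChain-length≤measure Φ Φ-decreasing zero    _       = z≤n
StrictChain-length≤measure Φ Φ-decreasing (suc l) (s , s<) =
  ≤-trans (s≤s (StrictChain-length≤measure Φ Φ-decreasing l (s ∘ fsuc , s< ∘ fsuc)))
          (Φ-decreasing (s< fzero))

surjective⇒≥ : ∀ {m n} {f : Fin m → Fin n} → Surjective _≡_ _≡_ f → n ≤ m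
surjective⇒≥ f-surj =
  injective⇒≤ (inverseʳ⇒injective _ (RightInverse.inverseʳ (↠⇒↪ (mk↠ f-surj))))

¬¬-decidable : ∀ {n} (R : Rel₀ (Fin n)) → ¬ ¬ (∀ a b → Dec (R a b))
¬¬-decidable R = sequence rawApplicative λ a → sequence rawApplicative λ b → ¬¬-excluded-middle
  where open RawMonad ¬¬-Monad using (rawApplicative)

module _ {m k} (c : Fin m → Fin k) {P : Pred (Fin m) 0ℓ} (P? : Decidable P) where

  meetsFibre? : ∀ j → Dec (∃ λ s → c s ≡ j × P s)
  meetsFibre? j = any? λ s → (c s ≟ j) ×-dec P? s

  image : Subset k
  image = tabulate λ j → ⌊ meetsFibre? j ⌋

  ∈-image⁻ : ∀ {j} → j ∈ image → ∃ λ s → c s ≡ j × P s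
  ∈-image⁻ {j} j∈ = toWitness {a? = meetsFibre? j}
    (Equivalence.from T-≡ (trans (sym (lookup∘tabulate _ j)) ([]=⇒lookup j∈)))

  ∈-image⁺ : ∀ {s} → P s → c s ∈ image
  ∈-image⁺ {s} Ps = lookup⇒[]= (c s) image
    (trans (lookup∘tabulate _ (c s))
           (Equivalence.to T-≡ (fromWitness {a? = meetsFibre? (c s)} (s , refl , Ps))))

module _ {m k} (c : Fin m → Fin k) {P Q : Pred (Fin m) 0ℓ} (P? : Decidable P) (Q? : Decidable Q) where

  image-mono : P ⊆ Q → image c P? ⊆ₛ image c Q?
  image-mono P⊆Q j∈ with ∈-image⁻ c P? j∈
  ... | s , refl , Ps = ∈-image⁺ c Q? (P⊆Q Ps)

  image-strict : P ⊆ Q → ∀ {s} → Q s → ¬ P s → (∀ {t} → c t ≡ c s → P t → P s) →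
                 image c P? ⊂ image c Q?
  image-strict P⊆Q {s} Qs ¬Ps P-fibre-closed =
    image-mono P⊆Q , c s , ∈-image⁺ c Q? Qs , λ cs∈ →
      let t , ct≡cs , Pt = ∈-image⁻ c P? cs∈ in ¬Ps (P-fibre-closed ct≡cs Pt)

module _ {n} {R : Rel₀ (Fin n)} (R-trans : Transitive₀ R) (R? : ∀ a b → Dec (R a b)) where

  Above : Subset n → Pred (Fin n) 0ℓ
  Above A s = ∃ λ a → a ∈ A × R a s

  Above? : ∀ A → Decidable (Above A)
  Above? A s = any? λ a → (a ∈? A) ×-dec R? a s

  Above-antitone : ∀ {A B} → Lift R A B → Above B ⊆ Above A
  Above-antitone A≤B (b , b∈B , bRs) =
    let a , a∈A , aRb = A≤B b b∈B in a , a∈A , R-trans aRb bRs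

  Above-respects-Equiv : ∀ A {s t} → Equiv R s t → Above A s → Above A t
  Above-respects-Equiv A (inj₁ refl)        above = above
  Above-respects-Equiv A (inj₂ (sRt , _)) (a , a∈A , aRs) = a , a∈A , R-trans aRs sRt

  ¬Lift⇒∉Above : ∀ {A B} → ¬ Lift R B A → ∃ λ a → a ∈ A × ¬ Above B a
  ¬Lift⇒∉Above {A} {B} B≰A with any? (λ a → (a ∈? A) ×-dec ¬? (Above? B a))
  ... | yes witness = witness
  ... | no  none    = contradiction
    (λ a a∈A → decidable-stable (Above? B a) λ a∉ → none (a , a∈A , a∉)) B≰A

  AtOrAbove : Subset n → Pred (Fin n) 0ℓ
  AtOrAbove A = (_∈ A) ∪ Above A

  AtOrAbove? : ∀ A → Decidable (AtOrAbove A)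
  AtOrAbove? A = (_∈? A) ∪? Above? A

  Lift⇒AtOrAbove⊆Above : ∀ {A B} → Lift R A B → AtOrAbove B ⊆ Above A
  Lift⇒AtOrAbove⊆Above A≤B (inj₁ b∈B)  = A≤B _ b∈B
  Lift⇒AtOrAbove⊆Above A≤B (inj₂ above) = Above-antitone A≤B above

  module _ {k} (c : Fin n → Fin k) (c-classes : ∀ {s t} → c s ≡ c t → Equiv R s t) where

    height : Subset n → ℕ
    height A = ∣ image c (Above? A) ∣ + ∣ image c (AtOrAbove? A) ∣

    height≤2*k : ∀ A → height A ≤ 2 * k
    height≤2*k A =
      +-mono-≤ (∣p∣≤n (image c (Above? A))) (≤-trans (∣p∣≤n (image c (AtOrAbove? A))) (m≤m+n k 0))

    height-decreasing : ∀ {A B} → Strict (Lift R) A B → height B < height A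
    height-decreasing {A} {B} (A≤B , B≰A) = begin-strict
      ∣ image c (Above? B) ∣ + ∣ image c (AtOrAbove? B) ∣
        <⟨ +-mono-<-≤ Above-B<AtOrAbove-A AtOrAbove-B≤Above-A ⟩
      ∣ image c (AtOrAbove? A) ∣ + ∣ image c (Above? A) ∣
        ≡⟨ +-comm ∣ image c (AtOrAbove? A) ∣ _ ⟩
      ∣ image c (Above? A) ∣ + ∣ image c (AtOrAbove? A) ∣ ∎
      where
      open ≤-Reasoning
      AtOrAbove-B≤Above-A : ∣ image c (AtOrAbove? B) ∣ ≤ ∣ image c (Above? A) ∣
      AtOrAbove-B≤Above-A =
        p⊆q⇒∣p∣≤∣q∣ (image-mono c (AtOrAbove? B) (Above? A) (Lift⇒AtOrAbove⊆Above A≤B))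
      Above-B<AtOrAbove-A : ∣ image c (Above? B) ∣ < ∣ image c (AtOrAbove? A) ∣
      Above-B<AtOrAbove-A =
        let a , a∈A , a∉ = ¬Lift⇒∉Above B≰A
        in p⊂q⇒∣p∣<∣q∣ (image-strict c (Above? B) (AtOrAbove? A)
                         (inj₂ ∘ Above-antitone A≤B) (inj₁ a∈A) a∉
                         λ ct≡ca → Above-respects-Equiv B (c-classes ct≡ca))

  mcl≤2*classCount : ∀ {k l} → HasClassCount R k → IsMCL (Lift R) l → l ≤ 2 * k
  mcl≤2*classCount {k} {l} (c , _ , c-classes) (chain , _) =
    ≤-trans (StrictChain-length≤measure (height c classes) (height-decreasing c classes) l chain)
            (height≤2*k c classes (proj₁ chain fzero))
    where
    classes : ∀ {s t} → c s ≡ c t → Equiv R s t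
    classes = Equivalence.to (c-classes _ _)

proposition4p11 : (n : ℕ) (R : Rel₀ (Fin (suc n))) → Transitive₀ R →
    Transitive₀ (Lift R) ×
    (∀ k l → HasClassCount R k → IsMCL (Lift R) l → (l ≤ 2 * k) × (2 * k ≤ 2 * suc n))
proposition4p11 n R R-trans = Lift-trans R-trans , bounds
  where
  bounds : ∀ k l → HasClassCount R k → IsMCL (Lift R) l → (l ≤ 2 * k) × (2 * k ≤ 2 * suc n)
  bounds k l classCount mcl =
    decidable-stable (l ≤? 2 * k)
      (¬¬-map (λ R? → mcl≤2*classCount R-trans R? classCount mcl) (¬¬-decidable R)) ,
    *-monoʳ-≤ 2 (surjective⇒≥ (proj₁ (proj₂ classCount)))
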